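{- Let $p$ be a Sophie Germain prime with $p\equiv 3$ or $5 \pmod 8$, and let $k\geq 0$ be an integer. Then the only non-negative integer solutions of the equation $p^x+(2^{2k+1}(2p+1))^y=z^2$ are $(p,x,y,z)=(3,1,0,2)$ (for any $k$) and $(p,k,x,y,z)=(3,2,0,1,15)$.
   Context: A prime $p$ is called a Sophie Germain prime if $2p+1$ is also prime. -}

module Defs where

open import Data.Nat using (ℕ; _+_; _*_; _^_)
open import Data.Nat.Primality using (Prime)
open import Data.Product using (_×_)

SophieGermainPrime : ℕ → Set
SophieGermainPrime p = Prime p × Prime (2 * p + 1)

-- Write q = 2p + 1 and m = (2k + 1)y, so that the equation reads p^x + 2^m q^y = z².
-- For m = 0, p^x = (z − 1)(z + 1) is a product of powers of p differing by 2, so p^x = 3.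
-- For m = 1, an odd x would make 2 a square modulo p, which Thue's lemma rules out for
-- p ≡ ±3 (mod 8), while an even x gives z² ≡ 7 (mod 8). For m = 2, z − 2q and z + 2q are
-- powers of p, which forces the impossible p^x = 8p + 5.
-- For m ≥ 3, z² ≡ p^x (mod 8) forces x = 2h, and then z = p^h + 2u where
-- u(u + p^h) = 2^(m−2) q^y with coprime factors. So (u, u + p^h) is (1, 2^(m−2) q^y),
-- (2^(m−2), q^y) or (q^y, 2^(m−2)). Congruences modulo p, 3, 8 and 16, together with the
-- difference of squares q^(2b) − p^(2a) = 2^(m−2) in the second case, leave only
-- q^y + p^h = 2^(m−2) with p = 3, h = 0, y = 1 and m = 5, that is k = 2 and z = 15.

module Submission where

open import Defs
open import Data.Empty using (⊥; ⊥-elim)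
open import Data.Fin using (Fin; toℕ; fromℕ<)
open import Data.Fin.Properties using (pigeonhole; toℕ-fromℕ<; toℕ<n)
import Data.Integer as ℤ
open import Data.Integer using (ℤ; _⊖_)
import Data.Integer.Properties as ℤ
import Data.Integer.Tactic.RingSolver as ℤ-Solver
open import Data.Nat
open import Data.Nat.Coprimality using (Coprime; coprime-divisor; coprime-+; 1-coprimeTo)
  renaming (sym to coprime-sym)
open import Data.Nat.Divisibility
open import Data.Nat.DivMod hiding (_mod_)
open import Data.Nat.Induction using (<-wellFounded)
open import Data.Nat.Primality
open import Data.Nat.Properties
open import Data.Nat.Tactic.RingSolver using (solve-∀)
open import Data.Product
open import Data.Sum using (_⊎_; inj₁; inj₂; [_,_]′)
import Data.Sum as Sum
open import Function using (case_of_; id; _$_)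
open import Induction.WellFounded using (Acc; acc)
open import Level using (0ℓ)
open import Relation.Binary.Bundles using (Setoid)
import Relation.Binary.Reasoning.Setoid as SetoidReasoning
open import Relation.Nullary
open import Relation.Nullary.Decidable using (from-yes; from-no)
open import Relation.Binary.Definitions using (tri<; tri≈; tri>)
open import Relation.Binary.PropositionalEquality

private variable a b c e j k m n o p r s u v x y z M N : ℕ

^-distrib-* : ∀ m n o → (m * n) ^ o ≡ m ^ o * n ^ o
^-distrib-* m n zero    = refl
^-distrib-* m n (suc o) rewrite ^-distrib-* m n o = interchange m n (m ^ o) (n ^ o)
  where
  interchange : ∀ a b c d → a * b * (c * d) ≡ a * c * (b * d)
  interchange = solve-∀

^-double : ∀ m a → m ^ (2 * a) ≡ m ^ a * m ^ a
^-double m a = trans (^-distribˡ-+-* m a (a + 0)) (cong (λ e → m ^ a * m ^ e) (+-identityʳ a))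

[2^a*b]^y : ∀ a b y → (2 ^ a * b) ^ y ≡ 2 ^ (a * y) * b ^ y
[2^a*b]^y a b y = trans (^-distrib-* (2 ^ a) b y) (cong (_* b ^ y) (^-*-assoc 2 a y))

^-injectiveʳ : 1 < b → b ^ m ≡ b ^ n → m ≡ n
^-injectiveʳ {b} {m} {n} 1<b eq with <-cmp m n
... | tri< m<n _ _ = contradiction eq (<⇒≢ (^-monoʳ-< b 1<b m<n))
... | tri≈ _ m≡n _ = m≡n
... | tri> _ _ n<m = contradiction (sym eq) (<⇒≢ (^-monoʳ-< b 1<b n<m))

b^c∣b^[c+h] : ∀ b c h → b ^ c ∣ b ^ (c + h)
b^c∣b^[c+h] b c h = divides (b ^ h) (trans (^-distribˡ-+-* b c h) (*-comm (b ^ c) (b ^ h)))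

b^c≤b^j⇒b^c∣b^j : 1 < b → b ^ c ≤ b ^ j → b ^ c ∣ b ^ j
b^c≤b^j⇒b^c∣b^j {b} {c} {j} 1<b b^c≤b^j =
  subst (λ e → b ^ c ∣ b ^ e) (m+[n∸m]≡n c≤j) (b^c∣b^[c+h] b c (j ∸ c))
  where
  c≤j : c ≤ j
  c≤j = ≮⇒≥ λ j<c → <⇒≱ (^-monoʳ-< b 1<b j<c) b^c≤b^j

prime∣prime⇒≡ : Prime p → Prime n → p ∣ n → p ≡ n
prime∣prime⇒≡ p-prime n-prime p∣n with prime⇒irreducible n-prime p∣n
... | inj₁ refl = ⊥-elim (¬prime[1] p-prime)
... | inj₂ p≡n  = p≡n

prime∣^⇒prime∣ : Prime p → ∀ n → p ∣ m ^ n → p ∣ m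
prime∣^⇒prime∣ p-prime zero    p∣1 = ⊥-elim (¬prime[1] (subst Prime (∣1⇒≡1 p∣1) p-prime))
prime∣^⇒prime∣ p-prime (suc n) p∣m*m^n with euclidsLemma _ _ p-prime p∣m*m^n
... | inj₁ p∣m   = p∣m
... | inj₂ p∣m^n = prime∣^⇒prime∣ p-prime n p∣m^n

prime∤⇒coprime : Prime p → ¬ p ∣ m → Coprime m p
prime∤⇒coprime p-prime p∤m (i∣m , i∣p) with prime⇒irreducible p-prime i∣p
... | inj₁ i≡1 = i≡1
... | inj₂ refl = contradiction i∣m p∤m

coprime-* : Coprime m n → Coprime m o → Coprime m (n * o)
coprime-* {m} m⊥n m⊥o (i∣m , i∣n*o) = m⊥o (i∣m , coprime-divisor i⊥n i∣n*o)
  where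
  i⊥n : Coprime _ _
  i⊥n (j∣i , j∣n) = m⊥n (∣-trans j∣i i∣m , j∣n)

coprime-^ : Coprime m n → ∀ k → Coprime m (n ^ k)
coprime-^ m⊥n zero    = coprime-sym (1-coprimeTo _)
coprime-^ m⊥n (suc k) = coprime-* m⊥n (coprime-^ m⊥n k)

∣p^n⇒≡p^i : Prime p → ∀ n → m ∣ p ^ n → ∃[ i ] m ≡ p ^ i
∣p^n⇒≡p^i p-prime zero m∣1 = 0 , ∣1⇒≡1 m∣1
∣p^n⇒≡p^i {p} {m} p-prime (suc n) m∣p^[1+n] with p ∣? m
... | no p∤m = ∣p^n⇒≡p^i p-prime n (coprime-divisor (prime∤⇒coprime p-prime p∤m) m∣p^[1+n])
... | yes (divides e refl) =
  let i , e≡p^i = ∣p^n⇒≡p^i {m = e} p-prime n (*-cancelʳ-∣ p {{prime⇒nonZero p-prime}} e*p∣p^n*p)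
  in suc i , trans (cong (_* p) e≡p^i) (*-comm (p ^ i) p)
  where
  e*p∣p^n*p : e * p ∣ p ^ n * p
  e*p∣p^n*p = subst (e * p ∣_) (*-comm p (p ^ n)) m∣p^[1+n]

∣p^n⇒≡1⊎p∣ : Prime p → ∀ n → m ∣ p ^ n → m ≡ 1 ⊎ p ∣ m
∣p^n⇒≡1⊎p∣ {p} p-prime n m∣p^n with ∣p^n⇒≡p^i p-prime n m∣p^n
... | zero  , m≡1   = inj₁ m≡1
... | suc i , refl  = inj₂ (m∣m*n (p ^ i))

prime∤⇒coprime-^ : Prime p → ¬ p ∣ m → ∀ k → Coprime m (p ^ k)
prime∤⇒coprime-^ p-prime p∤m = coprime-^ (prime∤⇒coprime p-prime p∤m)

coprime-factorisation : u * v ≡ m * n → Coprime u n → Coprime v m → u ≡ m × v ≡ n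
coprime-factorisation {u} {v} {m} {n} uv≡mn u⊥n v⊥m = ∣-antisym u∣m m∣u , ∣-antisym v∣n n∣v
  where
  u∣m : u ∣ m
  u∣m = coprime-divisor u⊥n (divides v (trans (*-comm n m) (trans (sym uv≡mn) (*-comm u v))))
  m∣u : m ∣ u
  m∣u = coprime-divisor (coprime-sym v⊥m) (divides n (trans (*-comm v u) (trans uv≡mn (*-comm m n))))
  v∣n : v ∣ n
  v∣n = coprime-divisor v⊥m (divides u (sym uv≡mn))
  n∣v : n ∣ v
  n∣v = coprime-divisor (coprime-sym u⊥n) (divides m uv≡mn)

prime∤-one-factor : Prime p → Coprime u v → ¬ p ∣ u ⊎ ¬ p ∣ v
prime∤-one-factor {p} {u} p-prime u⊥v with p ∣? u
... | no  p∤u = inj₁ p∤u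
... | yes p∣u = inj₂ λ p∣v → ¬prime[1] (subst Prime (u⊥v (p∣u , p∣v)) p-prime)

coprime-split : Prime a → Prime b → u * v ≡ a ^ M * b ^ N → Coprime u v →
                (u ≡ 1 × v ≡ a ^ M * b ^ N) ⊎ (u ≡ a ^ M × v ≡ b ^ N) ⊎
                (u ≡ b ^ N × v ≡ a ^ M) ⊎ (u ≡ a ^ M * b ^ N × v ≡ 1)
coprime-split {a} {b} {u} {v} {M} {N} a-prime b-prime uv≡ u⊥v
  with prime∤-one-factor a-prime u⊥v | prime∤-one-factor b-prime u⊥v
... | inj₁ a∤u | inj₁ b∤u = inj₁ $
  coprime-factorisation (trans uv≡ (sym (*-identityˡ _)))
    (coprime-* (prime∤⇒coprime-^ a-prime a∤u M) (prime∤⇒coprime-^ b-prime b∤u N))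
    (coprime-sym (1-coprimeTo v))
... | inj₂ a∤v | inj₁ b∤u = inj₂ $ inj₁ $
  coprime-factorisation uv≡ (prime∤⇒coprime-^ b-prime b∤u N) (prime∤⇒coprime-^ a-prime a∤v M)
... | inj₁ a∤u | inj₂ b∤v = inj₂ $ inj₂ $ inj₁ $
  coprime-factorisation (trans uv≡ (*-comm (a ^ M) (b ^ N)))
    (prime∤⇒coprime-^ a-prime a∤u M) (prime∤⇒coprime-^ b-prime b∤v N)
... | inj₂ a∤v | inj₂ b∤v = inj₂ $ inj₂ $ inj₂ $
  coprime-factorisation (trans uv≡ (sym (*-identityʳ _)))
    (coprime-sym (1-coprimeTo u))
    (coprime-* (prime∤⇒coprime-^ a-prime a∤v M) (prime∤⇒coprime-^ b-prime b∤v N))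

data EvenOrOdd : ℕ → Set where
  even : ∀ h → EvenOrOdd (2 * h)
  odd  : ∀ h → EvenOrOdd (1 + 2 * h)

even-or-odd : ∀ n → EvenOrOdd n
even-or-odd zero = even 0
even-or-odd (suc n) with even-or-odd n
... | even h = odd h
... | odd h  = subst EvenOrOdd (cong suc (+-suc h (h + 0))) (even (suc h))

2∤1+2n : ∀ n → ¬ 2 ∣ 1 + 2 * n
2∤1+2n n (divides q 1+2n≡q*2) = even≢odd q n (trans (*-comm 2 q) (sym 1+2n≡q*2))

1+2k∣2^M⇒k≡0 : ∀ M → 1 + 2 * k ∣ 2 ^ M → k ≡ 0
1+2k∣2^M⇒k≡0 {k} M odd∣2^M with ∣p^n⇒≡p^i prime[2] M odd∣2^M
... | zero  , 1+2k≡1 = [ (λ ()) , id ]′ (m*n≡0⇒m≡0∨n≡0 2 (suc-injective 1+2k≡1))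
... | suc i , 1+2k≡2^i = ⊥-elim (2∤1+2n k (subst (2 ∣_) (sym 1+2k≡2^i) (m∣m*n (2 ^ i))))

odd*odd≢2+2c : ∀ k b c → (2 * k + 1) * (1 + 2 * b) ≢ 2 + 2 * c
odd*odd≢2+2c k b c eq = even≢odd (1 + c) (k + b + 2 * k * b) (begin
  2 * (1 + c)                  ≡⟨ double c ⟩
  2 + 2 * c                    ≡⟨ eq ⟨
  (2 * k + 1) * (1 + 2 * b)    ≡⟨ expand k b ⟩
  suc (2 * (k + b + 2 * k * b)) ∎)
  where
  open ≡-Reasoning
  double : ∀ c → 2 * (1 + c) ≡ 2 + 2 * c
  double = solve-∀
  expand : ∀ k b → (2 * k + 1) * (1 + 2 * b) ≡ suc (2 * (k + b + 2 * k * b))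
  expand = solve-∀

odd*y≡2+M⇒1≤y : ∀ k y → (2 * k + 1) * y ≡ 2 + M → 1 ≤ y
odd*y≡2+M⇒1≤y k zero eq = case trans (sym (*-zeroʳ (2 * k + 1))) eq of λ ()
odd*y≡2+M⇒1≤y k (suc y) _ = s≤s z≤n

odd*y≡4⇒y≡4 : ∀ k y → (2 * k + 1) * y ≡ 4 → y ≡ 4
odd*y≡4⇒y≡4 k y odd*y≡4
  with 1+2k∣2^M⇒k≡0 {k} 2 (divides y (trans (sym odd*y≡4) (trans (*-comm (2 * k + 1) y)
                                                                 (cong (y *_) (+-comm (2 * k) 1)))))
... | refl = trans (sym (+-identityʳ y)) odd*y≡4

-- Congruences

infix 4 _≡_mod_
-- A record rather than a function, so that both sides can be inferred from a congruence.
record _≡_mod_ (m n d : ℕ) .{{_ : NonZero d}} : Set where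
  constructor congruent
  field residues-equal : m % d ≡ n % d
open _≡_mod_ public

module _ {d : ℕ} .{{_ : NonZero d}} where

  ≡⇒≡-mod : a ≡ b → a ≡ b mod d
  ≡⇒≡-mod a≡b = congruent (cong (_% d) a≡b)

  ≡-mod-sym : a ≡ b mod d → b ≡ a mod d
  ≡-mod-sym (congruent eq) = congruent (sym eq)

  ≡-mod-trans : a ≡ b mod d → b ≡ c mod d → a ≡ c mod d
  ≡-mod-trans (congruent eq) (congruent eq′) = congruent (trans eq eq′)

  ≡-mod-setoid : Setoid 0ℓ 0ℓ
  ≡-mod-setoid = record
    { _≈_           = _≡_mod d
    ; isEquivalence = record { refl = congruent refl ; sym = ≡-mod-sym ; trans = ≡-mod-trans }
    }

  %-≡-mod : ∀ a → a % d ≡ a mod d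
  %-≡-mod a = congruent (m%n%n≡m%n a d)

  +-cong-mod : a ≡ b mod d → c ≡ e mod d → a + c ≡ b + e mod d
  +-cong-mod {a} {b} {c} {e} (congruent a≡b) (congruent c≡e) = congruent (begin
    (a + c) % d           ≡⟨ %-distribˡ-+ a c d ⟩
    (a % d + c % d) % d   ≡⟨ cong₂ (λ x y → (x + y) % d) a≡b c≡e ⟩
    (b % d + e % d) % d   ≡⟨ %-distribˡ-+ b e d ⟨
    (b + e) % d           ∎)
    where open ≡-Reasoning

  *-cong-mod : a ≡ b mod d → c ≡ e mod d → a * c ≡ b * e mod d
  *-cong-mod {a} {b} {c} {e} (congruent a≡b) (congruent c≡e) = congruent (begin
    (a * c) % d           ≡⟨ %-distribˡ-* a c d ⟩
    (a % d * (c % d)) % d ≡⟨ cong₂ (λ x y → (x * y) % d) a≡b c≡e ⟩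
    (b % d * (e % d)) % d ≡⟨ %-distribˡ-* b e d ⟨
    (b * e) % d           ∎)
    where open ≡-Reasoning

  *-congˡ-mod : ∀ a → b ≡ c mod d → a * b ≡ a * c mod d
  *-congˡ-mod a = *-cong-mod {a = a} (congruent refl)

  +-congˡ-mod : ∀ a → b ≡ c mod d → a + b ≡ a + c mod d
  +-congˡ-mod a = +-cong-mod {a = a} (congruent refl)

  +-congʳ-mod : ∀ c → a ≡ b mod d → a + c ≡ b + c mod d
  +-congʳ-mod c a≡b = +-cong-mod a≡b (congruent {c} refl)

  ^-cong-mod : ∀ k → a ≡ b mod d → a ^ k ≡ b ^ k mod d
  ^-cong-mod zero    a≡b = congruent refl
  ^-cong-mod (suc k) a≡b = *-cong-mod a≡b (^-cong-mod k a≡b)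

  ∣⇒≡0-mod : d ∣ a → a ≡ 0 mod d
  ∣⇒≡0-mod {a} d∣a = congruent (trans (n∣m⇒m%n≡0 a d d∣a) (sym (n∣m⇒m%n≡0 0 d (d ∣0))))

  ≡-mod⇒∣∸ : a ≡ b mod d → d ∣ b ∸ a
  ≡-mod⇒∣∸ {a} {b} (congruent a≡b) = divides (b / d ∸ a / d) (begin
    b ∸ a                                     ≡⟨ cong₂ _∸_ (m≡m%n+[m/n]*n b d) (m≡m%n+[m/n]*n a d) ⟩
    (b % d + b / d * d) ∸ (a % d + a / d * d) ≡⟨ cong (λ r → (b % d + _) ∸ (r + a / d * d)) a≡b ⟩
    (b % d + b / d * d) ∸ (b % d + a / d * d) ≡⟨ [m+n]∸[m+o]≡n∸o (b % d) _ _ ⟩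
    b / d * d ∸ a / d * d                     ≡⟨ *-distribʳ-∸ d (b / d) (a / d) ⟨
    (b / d ∸ a / d) * d                       ∎)
    where open ≡-Reasoning

  ^-≡1-mod : a ≡ 1 mod d → ∀ k → a ^ k ≡ 1 mod d
  ^-≡1-mod a≡1 k = ≡-mod-trans (^-cong-mod k a≡1) (≡⇒≡-mod (^-zeroˡ k))

  module _ (c²≡1 : c ^ 2 ≡ 1 mod d) where

    ^-even-mod : ∀ h → c ^ (2 * h) ≡ 1 mod d
    ^-even-mod h = ≡-mod-trans (≡⇒≡-mod (sym (^-*-assoc c 2 h))) (^-≡1-mod c²≡1 h)

    ^-odd-mod : ∀ h → c ^ (1 + 2 * h) ≡ c mod d
    ^-odd-mod h = ≡-mod-trans (*-congˡ-mod c (^-even-mod h)) (≡⇒≡-mod (*-identityʳ c))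

module ≡-mod-Reasoning (d : ℕ) .{{_ : NonZero d}} = SetoidReasoning (≡-mod-setoid {d})

-- Two is not a square modulo n when n ≡ ±3 (mod 8)

data SquareMod8 : ℕ → Set where
  0² : SquareMod8 0
  1² : SquareMod8 1
  4² : SquareMod8 4

square-mod-8 : ∀ a → SquareMod8 (a * a % 8)
square-mod-8 a = subst SquareMod8 (sym (%-distribˡ-* a a 8)) (residue (a % 8) (m%n<n a 8))
  where
  residue : ∀ r → r < 8 → SquareMod8 (r * r % 8)
  residue 0 _ = 0²
  residue 1 _ = 1²
  residue 2 _ = 4²
  residue 3 _ = 1²
  residue 4 _ = 0²
  residue 5 _ = 1²
  residue 6 _ = 4²
  residue 7 _ = 1²
  residue (suc (suc (suc (suc (suc (suc (suc (suc _)))))))) (s≤s (s≤s (s≤s (s≤s (s≤s (s≤s (s≤s (s≤s ()))))))))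

square≡⇒SquareMod8 : ∀ a → a * a ≡ r mod 8 → SquareMod8 (r % 8)
square≡⇒SquareMod8 a (congruent eq) = subst SquareMod8 eq (square-mod-8 a)

≡3,5⇒¬SquareMod8 : ∀ n → n % 8 ≡ 3 ⊎ n % 8 ≡ 5 → ¬ SquareMod8 (n % 8)
≡3,5⇒¬SquareMod8 n (inj₁ n≡3) square = case subst SquareMod8 n≡3 square of λ ()
≡3,5⇒¬SquareMod8 n (inj₂ n≡5) square = case subst SquareMod8 n≡5 square of λ ()

2b²≢a²+n : ∀ n a b → n % 8 ≡ 3 ⊎ n % 8 ≡ 5 → 2 * (b * b) ≢ a * a + n
2b²≢a²+n n a b n≡3,5 2b²≡a²+n =
  residues (square-mod-8 a) (square-mod-8 b) (subst (λ r → r ≡ 3 ⊎ r ≡ 5) n≡form n≡3,5)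
  where
  -- n ≡ 2b² + 7a² (mod 8), and 2β + 7α never hits 3 or 5 for square residues α, β.
  n≡form : n % 8 ≡ (2 * (b * b % 8) + 7 * (a * a % 8)) % 8
  n≡form = residues-equal (begin
    n                                   ≈⟨ congruent (%-remove-+ʳ n (divides (a * a) (*-comm 8 (a * a)))) ⟨
    n + 8 * (a * a)                     ≡⟨ rearrange n a b 2b²≡a²+n ⟩
    2 * (b * b) + 7 * (a * a)           ≈⟨ +-cong-mod (*-congˡ-mod 2 (%-≡-mod (b * b)))
                                                      (*-congˡ-mod 7 (%-≡-mod (a * a))) ⟨
    2 * (b * b % 8) + 7 * (a * a % 8)   ∎)
    where
    open ≡-mod-Reasoning 8
    rearrange : ∀ n a b → 2 * (b * b) ≡ a * a + n → n + 8 * (a * a) ≡ 2 * (b * b) + 7 * (a * a)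
    rearrange n a b eq = trans (regroup n a) (cong (_+ 7 * (a * a)) (sym eq))
      where
      regroup : ∀ n a → n + 8 * (a * a) ≡ a * a + n + 7 * (a * a)
      regroup = solve-∀
  residues : ∀ {α β} → SquareMod8 α → SquareMod8 β →
             ¬ ((2 * β + 7 * α) % 8 ≡ 3 ⊎ (2 * β + 7 * α) % 8 ≡ 5)
  residues 0² 0² = λ { (inj₁ ()) ; (inj₂ ()) }
  residues 0² 1² = λ { (inj₁ ()) ; (inj₂ ()) }
  residues 0² 4² = λ { (inj₁ ()) ; (inj₂ ()) }
  residues 1² 0² = λ { (inj₁ ()) ; (inj₂ ()) }
  residues 1² 1² = λ { (inj₁ ()) ; (inj₂ ()) }
  residues 1² 4² = λ { (inj₁ ()) ; (inj₂ ()) }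
  residues 4² 0² = λ { (inj₁ ()) ; (inj₂ ()) }
  residues 4² 1² = λ { (inj₁ ()) ; (inj₂ ()) }
  residues 4² 4² = λ { (inj₁ ()) ; (inj₂ ()) }

even-square⇒even : ∀ a c → a * a ≡ 2 * c → ∃[ a′ ] a ≡ 2 * a′
even-square⇒even a c a²≡2c with even-or-odd a
... | even h = h , refl
... | odd h  = contradiction (trans (sym a²≡2c) (odd-square h)) (even≢odd c (2 * h + 2 * (h * h)))
  where
  odd-square : ∀ h → (1 + 2 * h) * (1 + 2 * h) ≡ suc (2 * (2 * h + 2 * (h * h)))
  odd-square = solve-∀

halve-square : ∀ a c → (2 * a) * (2 * a) ≡ 2 * c → c ≡ 2 * (a * a)
halve-square a c eq = *-cancelˡ-≡ c (2 * (a * a)) 2 (trans (sym eq) (double a))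
  where
  double : ∀ a → (2 * a) * (2 * a) ≡ 2 * (2 * (a * a))
  double = solve-∀

√2-irrational : ∀ a b → a * a ≡ 2 * (b * b) → b ≡ 0
√2-irrational a b = descent a b (<-wellFounded b)
  where
  descent : ∀ a b → Acc _<_ b → a * a ≡ 2 * (b * b) → b ≡ 0
  descent a zero    _             _       = refl
  descent a (suc b) (acc smaller) a²≡2b² with even-square⇒even a (suc b * suc b) a²≡2b²
  ... | a′ , refl with even-square⇒even (suc b) (a′ * a′) (halve-square a′ (suc b * suc b) a²≡2b²)
  ...   | zero    , ()
  ...   | suc b′ , 1+b≡2b′ =
    contradiction (descent a′ (suc b′) (smaller b′<b) (halve-square (suc b′) (a′ * a′) b²≡2a′²)) λ ()
    where
    b′<b : suc b′ < suc b
    b′<b = subst (suc b′ <_) (sym 1+b≡2b′) (m<m+n (suc b′) (s≤s z≤n))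
    b²≡2a′² : (2 * suc b′) * (2 * suc b′) ≡ 2 * (a′ * a′)
    b²≡2a′² = subst (λ B → B * B ≡ 2 * (a′ * a′)) 1+b≡2b′ (halve-square a′ (suc b * suc b) a²≡2b²)

integer-sqrt : ∀ n → ∃[ r ] r * r ≤ n × n < suc r * suc r
integer-sqrt zero = 0 , z≤n , s≤s z≤n
integer-sqrt (suc n) with integer-sqrt n
... | r , r²≤n , n<s² with suc n <? suc r * suc r
...   | yes 1+n<s² = r , m≤n⇒m≤1+n r²≤n , 1+n<s²
...   | no  1+n≮s² =
  suc r , ≤-reflexive (sym 1+n≡s²) , subst (_< suc (suc r) * suc (suc r)) (sym 1+n≡s²) s²<[1+s]²
  where
  1+n≡s² : suc n ≡ suc r * suc r
  1+n≡s² = ≤-antisym n<s² (≮⇒≥ 1+n≮s²)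
  s²<[1+s]² : suc r * suc r < suc (suc r) * suc (suc r)
  s²<[1+s]² = *-mono-< (n<1+n (suc r)) (n<1+n (suc r))

thue : ∀ n .{{_ : NonZero n}} r z → n < suc r * suc r →
       ∃[ a₁ ] ∃[ b₁ ] ∃[ a₂ ] ∃[ b₂ ] (a₁ ≤ r × b₁ ≤ r × a₂ ≤ r × b₂ ≤ r) ×
         (a₁ , b₁) ≢ (a₂ , b₂) × a₁ + b₁ * z ≡ a₂ + b₂ * z mod n
thue n r z n<s² =
  let i , j , i<j , same = pigeonhole n<s² λ k → fromℕ< (m%n<n (value (toℕ k)) n)
  in  low (toℕ i) , high (toℕ i) , low (toℕ j) , high (toℕ j)
    , (low≤r (toℕ i) , high≤r i , low≤r (toℕ j) , high≤r j)
    , (λ digits≡ → <-irrefl (digits-injective digits≡) i<j)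
    , congruent (trans (sym (toℕ-fromℕ< _)) (trans (cong toℕ same) (toℕ-fromℕ< _)))
  where
  base = suc r
  low high value : ℕ → ℕ
  low k   = k % base
  high k  = k / base
  value k = low k + high k * z
  low≤r : ∀ k → low k ≤ r
  low≤r k = s≤s⁻¹ (m%n<n k base)
  high≤r : ∀ (k : Fin (base * base)) → high (toℕ k) ≤ r
  high≤r k = s≤s⁻¹ (m<n*o⇒m/o<n (toℕ<n k))
  digits-injective : ∀ {k l} → (low k , high k) ≡ (low l , high l) → k ≡ l
  digits-injective {k} {l} digits≡ = begin
    k                     ≡⟨ m≡m%n+[m/n]*n k base ⟩
    low k + high k * base ≡⟨ cong₂ (λ x y → x + y * base) (cong proj₁ digits≡) (cong proj₂ digits≡) ⟩
    low l + high l * base ≡⟨ m≡m%n+[m/n]*n l base ⟨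
    l                     ∎
    where open ≡-Reasoning

-- ℤ's +_ is opened only locally: globally it makes ℕ sections such as (a +_) ambiguous.
module _ where

  open import Data.Integer using (+_)

  square≡∣∣² : ∀ X → X ℤ.* X ≡ + (ℤ.∣ X ∣ * ℤ.∣ X ∣)
  square≡∣∣² (+ n)      = sym (ℤ.pos-* n n)
  square≡∣∣² ℤ.-[1+ n ] = refl

  ∣⊖∣≡∣-∣ : ∀ m n → ℤ.∣ m ⊖ n ∣ ≡ ∣ m - n ∣
  ∣⊖∣≡∣-∣ m n with ≤-total m n
  ... | inj₁ m≤n = trans (ℤ.∣⊖∣-≤ m≤n) (sym (m≤n⇒∣m-n∣≡n∸m m≤n))
  ... | inj₂ n≤m = trans (ℤ.∣m⊖n∣≡∣n⊖m∣ m n) (trans (ℤ.∣⊖∣-≤ n≤m) (sym (m≤n⇒∣n-m∣≡n∸m n≤m)))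

  square-of-difference : ∀ a b → (+ a ℤ.- + b) ℤ.* (+ a ℤ.- + b) ≡ + (∣ a - b ∣ * ∣ a - b ∣)
  square-of-difference a b = trans (square≡∣∣² (+ a ℤ.- + b))
    (cong (λ m → + (m * m)) (trans (cong ℤ.∣_∣ (ℤ.[+m]-[+n]≡m⊖n a b)) (∣⊖∣≡∣-∣ a b)))

  pos-+-* : ∀ a b c → + (a + b * c) ≡ + a ℤ.+ + b ℤ.* + c
  pos-+-* a b c = trans (ℤ.pos-+ a (b * c)) (cong (λ w → + a ℤ.+ w) (ℤ.pos-* b c))

  ≡-mod⇒ℤ-multiple : .{{_ : NonZero n}} → a ≡ b mod n → ∃[ k ] + a ℤ.- + b ≡ + n ℤ.* k
  ≡-mod⇒ℤ-multiple {n} {a} {b} (congruent a≡b) = + (a / n) ℤ.- + (b / n) , (begin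
    + a ℤ.- + b
      ≡⟨ cong₂ (λ x y → + x ℤ.- + y) (m≡m%n+[m/n]*n a n) (m≡m%n+[m/n]*n b n) ⟩
    + (a % n + a / n * n) ℤ.- + (b % n + b / n * n)
      ≡⟨ cong (λ r → + (r + a / n * n) ℤ.- + (b % n + b / n * n)) a≡b ⟩
    + (b % n + a / n * n) ℤ.- + (b % n + b / n * n)
      ≡⟨ cong₂ ℤ._-_ (pos-+-* (b % n) (a / n) n) (pos-+-* (b % n) (b / n) n) ⟩
    (+ (b % n) ℤ.+ + (a / n) ℤ.* + n) ℤ.- (+ (b % n) ℤ.+ + (b / n) ℤ.* + n)
      ≡⟨ cancel (+ (b % n)) (+ (a / n)) (+ (b / n)) (+ n) ⟩
    + n ℤ.* (+ (a / n) ℤ.- + (b / n))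
      ∎)
    where
    open ≡-Reasoning
    cancel : ∀ R A B N → (R ℤ.+ A ℤ.* N) ℤ.- (R ℤ.+ B ℤ.* N) ≡ N ℤ.* (A ℤ.- B)
    cancel = ℤ-Solver.solve-∀

  -- X² − 2Y² = (X + Yz)(X − Yz) + Y²(z² − 2), and both summands are multiples of n.
  norm-identity : ∀ X Y z n k l → X ℤ.+ Y ℤ.* z ≡ n ℤ.* k → z ℤ.* z ≡ n ℤ.* l ℤ.+ + 2 →
                  X ℤ.* X ℤ.- + 2 ℤ.* (Y ℤ.* Y) ≡ n ℤ.* (k ℤ.* (X ℤ.- Y ℤ.* z) ℤ.+ Y ℤ.* Y ℤ.* l)
  norm-identity X Y z n k l X+Yz≡nk z²≡nl+2 = begin
    X ℤ.* X ℤ.- + 2 ℤ.* (Y ℤ.* Y)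
      ≡⟨ factor X Y z ⟩
    (X ℤ.+ Y ℤ.* z) ℤ.* (X ℤ.- Y ℤ.* z) ℤ.+ Y ℤ.* Y ℤ.* (z ℤ.* z ℤ.- + 2)
      ≡⟨ cong₂ (λ u w → u ℤ.* (X ℤ.- Y ℤ.* z) ℤ.+ Y ℤ.* Y ℤ.* (w ℤ.- + 2)) X+Yz≡nk z²≡nl+2 ⟩
    n ℤ.* k ℤ.* (X ℤ.- Y ℤ.* z) ℤ.+ Y ℤ.* Y ℤ.* (n ℤ.* l ℤ.+ + 2 ℤ.- + 2)
      ≡⟨ collect X Y z n k l ⟩
    n ℤ.* (k ℤ.* (X ℤ.- Y ℤ.* z) ℤ.+ Y ℤ.* Y ℤ.* l) ∎
    where
    open ≡-Reasoning
    factor : ∀ X Y z → X ℤ.* X ℤ.- + 2 ℤ.* (Y ℤ.* Y) ≡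
                       (X ℤ.+ Y ℤ.* z) ℤ.* (X ℤ.- Y ℤ.* z) ℤ.+ Y ℤ.* Y ℤ.* (z ℤ.* z ℤ.- + 2)
    factor = ℤ-Solver.solve-∀
    collect : ∀ X Y z n k l → n ℤ.* k ℤ.* (X ℤ.- Y ℤ.* z) ℤ.+ Y ℤ.* Y ℤ.* (n ℤ.* l ℤ.+ + 2 ℤ.- + 2) ≡
                              n ℤ.* (k ℤ.* (X ℤ.- Y ℤ.* z) ℤ.+ Y ℤ.* Y ℤ.* l)
    collect = ℤ-Solver.solve-∀

  norm-divisible : ∀ {n} .{{_ : NonZero n}} z l a₁ b₁ a₂ b₂ →
                   z * z ≡ n * l + 2 → a₁ + b₁ * z ≡ a₂ + b₂ * z mod n →
                   let A = ∣ a₁ - a₂ ∣; B = ∣ b₁ - b₂ ∣ in n ∣ ∣ A * A - 2 * (B * B) ∣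
  norm-divisible {n} z l a₁ b₁ a₂ b₂ z²≡nl+2 congruence
    with k , difference≡nk ← ≡-mod⇒ℤ-multiple congruence = divides ℤ.∣ L k ∣ (begin
      ∣ A * A - 2 * (B * B) ∣              ≡⟨ ∣⊖∣≡∣-∣ (A * A) (2 * (B * B)) ⟨
      ℤ.∣ A * A ⊖ 2 * (B * B) ∣            ≡⟨ cong ℤ.∣_∣ (ℤ.[+m]-[+n]≡m⊖n (A * A) (2 * (B * B))) ⟨
      ℤ.∣ + (A * A) ℤ.- + (2 * (B * B)) ∣  ≡⟨ cong ℤ.∣_∣ (cong₂ ℤ._-_ X²≡A² 2Y²≡2B²) ⟨
      ℤ.∣ X ℤ.* X ℤ.- + 2 ℤ.* (Y ℤ.* Y) ∣  ≡⟨ cong ℤ.∣_∣ (norm-identity X Y (+ z) (+ n) k (+ l)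
                                                                   X+Yz≡nk z²≡nl+2′) ⟩
      ℤ.∣ + n ℤ.* L k ∣                    ≡⟨ ℤ.abs-* (+ n) (L k) ⟩
      n * ℤ.∣ L k ∣                        ≡⟨ *-comm n _ ⟩
      ℤ.∣ L k ∣ * n                        ∎)
    where
    open ≡-Reasoning
    A = ∣ a₁ - a₂ ∣
    B = ∣ b₁ - b₂ ∣
    X Y : ℤ
    X = + a₁ ℤ.- + a₂
    Y = + b₁ ℤ.- + b₂
    L : ℤ → ℤ
    L k = k ℤ.* (X ℤ.- Y ℤ.* + z) ℤ.+ Y ℤ.* Y ℤ.* + l
    X²≡A² : X ℤ.* X ≡ + (A * A)
    X²≡A² = square-of-difference a₁ a₂
    2Y²≡2B² : + 2 ℤ.* (Y ℤ.* Y) ≡ + (2 * (B * B))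
    2Y²≡2B² = trans (cong (λ w → + 2 ℤ.* w) (square-of-difference b₁ b₂)) (sym (ℤ.pos-* 2 (B * B)))
    X+Yz≡nk : X ℤ.+ Y ℤ.* + z ≡ + n ℤ.* k
    X+Yz≡nk = begin
      X ℤ.+ Y ℤ.* + z
        ≡⟨ regroup (+ a₁) (+ b₁) (+ a₂) (+ b₂) (+ z) ⟩
      (+ a₁ ℤ.+ + b₁ ℤ.* + z) ℤ.- (+ a₂ ℤ.+ + b₂ ℤ.* + z)
        ≡⟨ cong₂ ℤ._-_ (pos-+-* a₁ b₁ z) (pos-+-* a₂ b₂ z) ⟨
      + (a₁ + b₁ * z) ℤ.- + (a₂ + b₂ * z)
        ≡⟨ difference≡nk ⟩
      + n ℤ.* k
        ∎
      where
      regroup : ∀ a₁ b₁ a₂ b₂ z →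
                (a₁ ℤ.- a₂) ℤ.+ (b₁ ℤ.- b₂) ℤ.* z ≡ (a₁ ℤ.+ b₁ ℤ.* z) ℤ.- (a₂ ℤ.+ b₂ ℤ.* z)
      regroup = ℤ-Solver.solve-∀
    z²≡nl+2′ : + z ℤ.* + z ≡ + n ℤ.* + l ℤ.+ + 2
    z²≡nl+2′ = begin
      + z ℤ.* + z          ≡⟨ ℤ.pos-* z z ⟨
      + (z * z)            ≡⟨ cong +_ z²≡nl+2 ⟩
      + (n * l + 2)        ≡⟨ ℤ.pos-+ (n * l) 2 ⟩
      + (n * l) ℤ.+ + 2    ≡⟨ cong (λ w → w ℤ.+ + 2) (ℤ.pos-* n l) ⟩
      + n ℤ.* + l ℤ.+ + 2  ∎

∣∧<2*⇒≡0⊎≡ : n ∣ m → m < 2 * n → m ≡ 0 ⊎ m ≡ n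
∣∧<2*⇒≡0⊎≡ {n} (divides l refl) l*n<2*n with *-cancelʳ-< n l 2 l*n<2*n
... | z<s       = inj₁ refl
... | s<s z<s   = inj₂ (+-identityʳ n)

∣-∣-multiple : n ∣ ∣ a - c ∣ → a < n → c < 2 * n → a ≡ c ⊎ c ≡ a + n
∣-∣-multiple {n} {a} {c} n∣∣a-c∣ a<n c<2n with ≤-total c a
... | inj₁ c≤a with ∣∧<2*⇒≡0⊎≡ (subst (n ∣_) (m≤n⇒∣n-m∣≡n∸m c≤a) n∣∣a-c∣) a∸c<2n
  where
  a∸c<2n : a ∸ c < 2 * n
  a∸c<2n = ≤-<-trans (m∸n≤m a c) (<-≤-trans a<n (m≤m+n n (n + 0)))
...   | inj₁ a∸c≡0 = inj₁ (≤-antisym (m∸n≡0⇒m≤n a∸c≡0) c≤a)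
...   | inj₂ a∸c≡n = contradiction a<n (≤⇒≯ (subst (_≤ a) a∸c≡n (m∸n≤m a c)))
∣-∣-multiple {n} {a} {c} n∣∣a-c∣ a<n c<2n
    | inj₂ a≤c
    with ∣∧<2*⇒≡0⊎≡ (subst (n ∣_) (m≤n⇒∣m-n∣≡n∸m a≤c) n∣∣a-c∣) (≤-<-trans (m∸n≤m c a) c<2n)
...   | inj₁ c∸a≡0 = inj₁ (≤-antisym a≤c (m∸n≡0⇒m≤n c∸a≡0))
...   | inj₂ c∸a≡n = inj₂ (trans (sym (m+[n∸m]≡n a≤c)) (cong (a +_) c∸a≡n))

small-norm : ∀ n a b → n % 8 ≡ 3 ⊎ n % 8 ≡ 5 → a * a < n → b * b < n →
             n ∣ ∣ a * a - 2 * (b * b) ∣ → a ≡ 0 × b ≡ 0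
small-norm n a b n≡3,5 a²<n b²<n n∣norm with ∣-∣-multiple n∣norm a²<n (*-monoʳ-< 2 b²<n)
... | inj₁ a²≡2b² = a≡0 , b≡0
  where
  b≡0 = √2-irrational a b a²≡2b²
  a≡0 = [ id , id ]′ (m*n≡0⇒m≡0∨n≡0 a (trans a²≡2b² (cong (λ c → 2 * (c * c)) b≡0)))
... | inj₂ 2b²≡a²+n = contradiction 2b²≡a²+n (2b²≢a²+n n a b n≡3,5)

2-is-not-a-square-mod : ∀ n z t → n % 8 ≡ 3 ⊎ n % 8 ≡ 5 → z * z ≢ n * t + 2
2-is-not-a-square-mod n z t n≡3,5 z²≡nt+2 =
  let r , r²≤n , n<s² = integer-sqrt n
      a₁ , b₁ , a₂ , b₂ , (a₁≤r , b₁≤r , a₂≤r , b₂≤r) , distinct , congruence = thue n r z n<s²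
      A≡0 , B≡0 = small-norm n _ _ n≡3,5 (difference²<n r²≤n a₁≤r a₂≤r)
                    (difference²<n r²≤n b₁≤r b₂≤r) (norm-divisible z t a₁ b₁ a₂ b₂ z²≡nt+2 congruence)
  in  distinct (cong₂ _,_ (∣m-n∣≡0⇒m≡n A≡0) (∣m-n∣≡0⇒m≡n B≡0))
  where
  instance
    n≢0 : NonZero n
    n≢0 = ≢-nonZero λ n≡0 → [ (λ ()) , (λ ()) ]′ (subst (λ m → m % 8 ≡ 3 ⊎ m % 8 ≡ 5) n≡0 n≡3,5)
  n-non-square : ∀ r → r * r ≢ n
  n-non-square r r²≡n = ≡3,5⇒¬SquareMod8 n n≡3,5 (square≡⇒SquareMod8 r (≡⇒≡-mod r²≡n))
  difference²<n : ∀ {r a₁ a₂} → r * r ≤ n → a₁ ≤ r → a₂ ≤ r → ∣ a₁ - a₂ ∣ * ∣ a₁ - a₂ ∣ < n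
  difference²<n {r} {a₁} {a₂} r²≤n a₁≤r a₂≤r =
    ≤-<-trans (*-mono-≤ ∣a₁-a₂∣≤r ∣a₁-a₂∣≤r) (≤∧≢⇒< r²≤n (n-non-square r))
    where
    ∣a₁-a₂∣≤r : ∣ a₁ - a₂ ∣ ≤ r
    ∣a₁-a₂∣≤r = ≤-trans (∣m-n∣≤m⊔n a₁ a₂) (⊔-lub a₁≤r a₂≤r)

-- Differences of squares

square-difference : ∀ N s z → N + s * s ≡ z * z → ∃[ d ] z ≡ s + d × N ≡ d * (d + 2 * s)
square-difference N s z N+s²≡z² = z ∸ s , z≡s+d , +-cancelʳ-≡ (s * s) N _ (begin
  N + s * s                     ≡⟨ N+s²≡z² ⟩
  z * z                         ≡⟨ cong (λ w → w * w) z≡s+d ⟩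
  (s + d) * (s + d)             ≡⟨ expand s d ⟩
  d * (d + 2 * s) + s * s       ∎)
  where
  open ≡-Reasoning
  d = z ∸ s
  s≤z : s ≤ z
  s≤z = ≮⇒≥ λ z<s → <⇒≱ (*-mono-< z<s z<s) (subst (s * s ≤_) N+s²≡z² (m≤n+m (s * s) N))
  z≡s+d : z ≡ s + d
  z≡s+d = sym (m+[n∸m]≡n s≤z)
  expand : ∀ s d → (s + d) * (s + d) ≡ d * (d + 2 * s) + s * s
  expand = solve-∀

prime-power+square≡square : Prime p → ¬ p ∣ 2 * s → p ^ x + s * s ≡ z * z → z ≡ 1 + s
prime-power+square≡square {p} {s} {x} {z} p-prime p∤2s eq
  with d , z≡s+d , p^x≡d*e ← square-difference (p ^ x) s z eq
  with ∣p^n⇒≡1⊎p∣ p-prime x (divides (d + 2 * s) (trans p^x≡d*e (*-comm d _)))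
     | ∣p^n⇒≡1⊎p∣ p-prime x (divides d p^x≡d*e)
... | inj₁ d≡1 | _          = trans z≡s+d (trans (cong (s +_) d≡1) (+-comm s 1))
... | inj₂ p∣d | inj₂ p∣e   = contradiction (∣m+n∣m⇒∣n p∣e p∣d) p∤2s
... | inj₂ _   | inj₁ e≡1   = case subst (2 ≤_) e≡1 (≤-trans 2≤2s (m≤n+m (2 * s) d)) of λ { (s≤s ()) }
  where
  2≤2s : 2 ≤ 2 * s
  2≤2s = *-monoʳ-≤ 2 (n≢0⇒n>0 {s} λ { refl → p∤2s (p ∣0) })

prime-power≡3 : Prime p → p ^ x ≡ 3 → p ≡ 3 × x ≡ 1
prime-power≡3 {p} {zero}  p-prime ()
prime-power≡3 {p} {suc x} p-prime p^x≡3 =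
  p≡3 , ^-injectiveʳ {b = 3} (s≤s (s≤s z≤n)) (subst (λ b → b ^ suc x ≡ 3) p≡3 p^x≡3)
  where
  p≡3 : p ≡ 3
  p≡3 = prime∣prime⇒≡ p-prime (from-yes (prime? 3)) (subst (p ∣_) p^x≡3 (m∣m*n (p ^ x)))

prime-power+1≡square : Prime p → ¬ p ∣ 2 → p ^ x + 1 ≡ z * z → p ≡ 3 × x ≡ 1 × z ≡ 2
prime-power+1≡square {p} {x} {z} p-prime p∤2 eq
  with prime-power+square≡square {s = 1} {x} {z} p-prime p∤2 eq
... | refl = let p≡3 , x≡1 = prime-power≡3 p-prime (+-cancelʳ-≡ 1 (p ^ x) 3 eq) in p≡3 , x≡1 , refl

4N+square≡square : ∀ N s z → 4 * N + s * s ≡ z * z → ∃[ u ] z ≡ s + 2 * u × N ≡ u * (u + s)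
4N+square≡square N s z eq with d , z≡s+d , 4N≡d*e ← square-difference (4 * N) s z eq | even-or-odd d
... | even u = u , z≡s+d , *-cancelˡ-≡ N (u * (u + s)) 4 (trans 4N≡d*e (expand u s))
  where
  expand : ∀ u s → 2 * u * (2 * u + 2 * s) ≡ 4 * (u * (u + s))
  expand = solve-∀
... | odd h  = ⊥-elim $ even≢odd (2 * N) (2 * h * h + 2 * h * s + 2 * h + s) (begin
  2 * (2 * N)                                   ≡⟨ *-assoc 2 2 N ⟨
  4 * N                                         ≡⟨ 4N≡d*e ⟩
  (1 + 2 * h) * (1 + 2 * h + 2 * s)             ≡⟨ expand h s ⟩
  suc (2 * (2 * h * h + 2 * h * s + 2 * h + s)) ∎)
  where
  open ≡-Reasoning
  expand : ∀ h s → (1 + 2 * h) * (1 + 2 * h + 2 * s) ≡ suc (2 * (2 * h * h + 2 * h * s + 2 * h + s))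
  expand = solve-∀

2^M+odd²≡square : ∀ M R z → ¬ 2 ∣ R → 2 ^ M + R * R ≡ z * z → z ≡ R + 2
2^M+odd²≡square M R z 2∤R eq
  with d , z≡R+d , 2^M≡d*e ← square-difference (2 ^ M) R z eq
  with ∣p^n⇒≡p^i prime[2] M (divides (d + 2 * R) (trans 2^M≡d*e (*-comm d _)))
     | ∣p^n⇒≡p^i prime[2] M (divides d 2^M≡d*e)
... | 0 , refl           | j , e≡2^j =
  ⊥-elim (2∤R (subst (2 ∣_) (sym (1+2k∣2^M⇒k≡0 j (∣-reflexive e≡2^j))) (2 ∣0)))
... | 1 , refl           | _         = z≡R+d
... | suc (suc i) , refl | j , e≡2^j = ⊥-elim (2∤R (*-cancelˡ-∣ 2 4∣2R))
  where
  4≤d : 4 ≤ 2 ^ (2 + i)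
  4≤d = ^-monoʳ-≤ 2 (m≤m+n 2 i)
  4∣e : 4 ∣ 2 ^ (2 + i) + 2 * R
  4∣e = subst (4 ∣_) (sym e≡2^j) (b^c≤b^j⇒b^c∣b^j {c = 2} {j} (s≤s (s≤s z≤n))
          (subst (4 ≤_) e≡2^j (≤-trans 4≤d (m≤m+n _ (2 * R)))))
  4∣2R : 4 ∣ 2 * R
  4∣2R = ∣m+n∣m⇒∣n 4∣e (b^c∣b^[c+h] 2 2 i)

-- Exceptional small cases

b^[c+h]≢n : ∀ b c h → ¬ b ^ c ∣ n → b ^ (c + h) ≢ n
b^[c+h]≢n b c h b^c∤n b^[c+h]≡n = b^c∤n (subst (b ^ c ∣_) b^[c+h]≡n (b^c∣b^[c+h] b c h))

3^h≢9603 : ∀ h → 3 ^ h ≢ 9603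
3^h≢9603 0 ()
3^h≢9603 1 ()
3^h≢9603 2 ()
3^h≢9603 (suc (suc (suc h))) = b^[c+h]≢n 3 3 h (from-no (27 ∣? 9603))

3^h≢2397 : ∀ h → 3 ^ h ≢ 2397
3^h≢2397 0 ()
3^h≢2397 1 ()
3^h≢2397 (suc (suc h)) = b^[c+h]≢n 3 2 h (from-no (9 ∣? 2397))

5^h≢45 : ∀ h → 5 ^ h ≢ 45
5^h≢45 0 ()
5^h≢45 1 ()
5^h≢45 (suc (suc h)) = b^[c+h]≢n 5 2 h (from-no (25 ∣? 45))

7^y+3^h≡2^M : ∀ b h c → 7 ^ (1 + 2 * b) + 3 ^ h ≡ 2 ^ (1 + 2 * c) →
              h ≡ 0 × 1 + 2 * b ≡ 1 × 1 + 2 * c ≡ 3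
7^y+3^h≡2^M b (suc h) c eq = case mod-3 of λ { (congruent ()) }
  where
  mod-3 : 1 + 0 ≡ 2 mod 3
  mod-3 = begin
    1 + 0                             ≈⟨ +-cong-mod (^-≡1-mod {a = 7} (congruent refl) (1 + 2 * b))
                                                    (∣⇒≡0-mod (m∣m*n (3 ^ h))) ⟨
    7 ^ (1 + 2 * b) + 3 ^ suc h       ≡⟨ eq ⟩
    2 ^ (1 + 2 * c)                   ≈⟨ ≡-mod-trans (^-odd-mod {c = 2} (congruent refl) c) (congruent refl) ⟩
    2                                 ∎
    where open ≡-mod-Reasoning 3
7^y+3^h≡2^M b zero zero eq = case subst (8 ≤_) eq (+-monoˡ-≤ 1 7≤7^[1+2b]) of λ { (s≤s (s≤s ())) }
  where
  7≤7^[1+2b] : 7 ≤ 7 ^ (1 + 2 * b)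
  7≤7^[1+2b] = m≤m*n 7 (7 ^ (2 * b)) {{m^n≢0 7 (2 * b)}}
7^y+3^h≡2^M b zero 1 eq = refl , ^-injectiveʳ {b = 7} (s≤s (s≤s z≤n)) (+-cancelʳ-≡ 1 _ 7 eq) , refl
7^y+3^h≡2^M b zero (suc (suc c)) eq = case mod-16 of λ { (congruent ()) }
  where
  mod-16 : 7 + 1 ≡ 0 mod 16
  mod-16 = begin
    7 + 1                             ≈⟨ +-congʳ-mod 1 (^-odd-mod {c = 7} (congruent refl) b) ⟨
    7 ^ (1 + 2 * b) + 1               ≡⟨ eq ⟩
    2 ^ (1 + 2 * suc (suc c))         ≈⟨ ∣⇒≡0-mod (subst (λ e → 16 ∣ 2 ^ e) (exponent c)
                                                         (b^c∣b^[c+h] 2 4 (1 + 2 * c))) ⟩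
    0                                 ∎
    where
    open ≡-mod-Reasoning 16
    exponent : ∀ c → 4 + (1 + 2 * c) ≡ 1 + 2 * suc (suc c)
    exponent = solve-∀

-- Sophie Germain primes

module SophieGermain {p : ℕ} (p-prime : Prime p) (q-prime : Prime (2 * p + 1))
                     (p≡3,5 : p % 8 ≡ 3 ⊎ p % 8 ≡ 5) where

  q : ℕ
  q = 2 * p + 1

  instance
    p≢0 : NonZero p
    p≢0 = prime⇒nonZero p-prime

  2∤p : ¬ 2 ∣ p
  2∤p 2∣p = [ (λ ()) , (λ ()) ]′ (subst (λ n → n % 8 ≡ 3 ⊎ n % 8 ≡ 5) (sym 2≡p) p≡3,5)
    where 2≡p = prime∣prime⇒≡ prime[2] p-prime 2∣p

  3≤p : 3 ≤ p
  3≤p = ≤∧≢⇒< (nonTrivial⇒n>1 p {{prime⇒nonTrivial p-prime}}) λ 2≡p → 2∤p (subst (2 ∣_) 2≡p ∣-refl)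

  p∤1 : ¬ p ∣ 1
  p∤1 p∣1 = <⇒≱ (≤-trans (s≤s (s≤s z≤n)) 3≤p) (∣⇒≤ p∣1)

  p∤2 : ¬ p ∣ 2
  p∤2 p∣2 = <⇒≱ 3≤p (∣⇒≤ p∣2)

  p∤q : ¬ p ∣ q
  p∤q p∣q = p∤1 (∣m+n∣m⇒∣n p∣q (n∣m*n 2))

  7≤q : 7 ≤ q
  7≤q = +-monoˡ-≤ 1 (*-monoʳ-≤ 2 3≤p)

  instance
    q≢0 : NonZero q
    q≢0 = >-nonZero (≤-trans (s≤s z≤n) 7≤q)

  7≤q^y : 1 ≤ y → 7 ≤ q ^ y
  7≤q^y {suc y} _ = ≤-trans 7≤q (m≤m*n q (q ^ y) {{m^n≢0 q y}})

  1≤p^h : ∀ h → 1 ≤ p ^ h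
  1≤p^h h = m^n>0 p h

  residues-mod-8 : (p ≡ 3 mod 8 × q ≡ 7 mod 8) ⊎ (p ≡ 5 mod 8 × q ≡ 3 mod 8)
  residues-mod-8 = Sum.map (λ p≡3 → congruent p≡3 , q≡2r+1 {3} (congruent p≡3))
                           (λ p≡5 → congruent p≡5 , ≡-mod-trans (q≡2r+1 {5} (congruent p≡5)) (congruent refl))
                           p≡3,5
    where
    q≡2r+1 : ∀ {r} → p ≡ r mod 8 → q ≡ 2 * r + 1 mod 8
    q≡2r+1 p≡r = +-congʳ-mod 1 (*-congˡ-mod 2 p≡r)

  by-residues : {A : Set} → (p ≡ 3 mod 8 → q ≡ 7 mod 8 → A) → (p ≡ 5 mod 8 → q ≡ 3 mod 8 → A) → A
  by-residues f g = [ uncurry f , uncurry g ]′ residues-mod-8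

  p²≡1-mod-8 : p ^ 2 ≡ 1 mod 8
  p²≡1-mod-8 = by-residues (λ p≡3 _ → ≡-mod-trans (^-cong-mod 2 p≡3) (congruent refl))
                           (λ p≡5 _ → ≡-mod-trans (^-cong-mod 2 p≡5) (congruent refl))

  q²≡1-mod-8 : q ^ 2 ≡ 1 mod 8
  q²≡1-mod-8 = by-residues (λ _ q≡7 → ≡-mod-trans (^-cong-mod 2 q≡7) (congruent refl))
                           (λ _ q≡3 → ≡-mod-trans (^-cong-mod 2 q≡3) (congruent refl))

  2q≡6-mod-8 : 2 * q ≡ 6 mod 8
  2q≡6-mod-8 = by-residues (λ _ q≡7 → ≡-mod-trans (*-congˡ-mod 2 q≡7) (congruent refl))
                           (λ _ q≡3 → *-congˡ-mod 2 q≡3)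

  p≢1-mod-8 : ¬ p ≡ 1 mod 8
  p≢1-mod-8 p≡1 = by-residues (λ p≡3 _ → case ≡-mod-trans (≡-mod-sym p≡3) p≡1 of λ { (congruent ()) })
                              (λ p≡5 _ → case ≡-mod-trans (≡-mod-sym p≡5) p≡1 of λ { (congruent ()) })

  q≢1-mod-8 : ¬ q ≡ 1 mod 8
  q≢1-mod-8 q≡1 = by-residues (λ _ q≡7 → case ≡-mod-trans (≡-mod-sym q≡7) q≡1 of λ { (congruent ()) })
                              (λ _ q≡3 → case ≡-mod-trans (≡-mod-sym q≡3) q≡1 of λ { (congruent ()) })

  p≢q-mod-8 : ¬ p ≡ q mod 8
  p≢q-mod-8 p≡q = by-residues
    (λ p≡3 q≡7 → case ≡-mod-trans (≡-mod-sym p≡3) (≡-mod-trans p≡q q≡7) of λ { (congruent ()) })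
    (λ p≡5 q≡3 → case ≡-mod-trans (≡-mod-sym p≡5) (≡-mod-trans p≡q q≡3) of λ { (congruent ()) })

  1+p^h≢0-mod-8 : ∀ h → ¬ 1 + p ^ h ≡ 0 mod 8
  1+p^h≢0-mod-8 h 1+p^h≡0 with even-or-odd h
  ... | even a =
    case ≡-mod-trans (≡-mod-sym (+-congˡ-mod 1 (^-even-mod p²≡1-mod-8 a))) 1+p^h≡0 of λ { (congruent ()) }
  ... | odd a  = by-residues
    (λ p≡3 _ → case ≡-mod-trans (≡-mod-sym (1+p^h≡1+r p≡3)) 1+p^h≡0 of λ { (congruent ()) })
    (λ p≡5 _ → case ≡-mod-trans (≡-mod-sym (1+p^h≡1+r p≡5)) 1+p^h≡0 of λ { (congruent ()) })
    where
    1+p^h≡1+r : ∀ {r} → p ≡ r mod 8 → 1 + p ^ (1 + 2 * a) ≡ 1 + r mod 8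
    1+p^h≡1+r p≡r = +-congˡ-mod 1 (≡-mod-trans (^-odd-mod p²≡1-mod-8 a) p≡r)

  p^[1+h]≡0-mod-p : ∀ h → p ^ (1 + h) ≡ 0 mod p
  p^[1+h]≡0-mod-p h = ∣⇒≡0-mod (m∣m*n (p ^ h))

  q^y≡1-mod-p : ∀ y → q ^ y ≡ 1 mod p
  q^y≡1-mod-p = ^-≡1-mod (≡-mod-trans (+-congʳ-mod 1 (∣⇒≡0-mod (n∣m*n 2))) (congruent refl))

  1≢2-mod-p : ¬ 1 ≡ 2 mod p
  1≢2-mod-p 1≡2 = p∤1 (≡-mod⇒∣∸ 1≡2)

  1≡4-mod-p⇒p≡3 : 1 ≡ 4 mod p → p ≡ 3
  1≡4-mod-p⇒p≡3 1≡4 = prime∣prime⇒≡ p-prime (from-yes (prime? 3)) (≡-mod⇒∣∸ 1≡4)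

  p≡3∨p≡2-mod-3 : p ≡ 3 ⊎ (p ≡ 2 mod 3)
  p≡3∨p≡2-mod-3 = classify (p % 3) (m%n<n p 3) (%-≡-mod p)
    where
    classify : ∀ r → r < 3 → r ≡ p mod 3 → p ≡ 3 ⊎ (p ≡ 2 mod 3)
    classify 0 _ 0≡p = inj₁ (sym (prime∣prime⇒≡ (from-yes (prime? 3)) p-prime (≡-mod⇒∣∸ 0≡p)))
    classify 1 _ 1≡p = ⊥-elim (<⇒≢ (≤-trans (s≤s (s≤s (s≤s (s≤s z≤n)))) 7≤q)
                                   (prime∣prime⇒≡ (from-yes (prime? 3)) q-prime 3∣q))
      where
      q≡0 : q ≡ 0 mod 3
      q≡0 = ≡-mod-trans (+-congʳ-mod 1 (*-congˡ-mod 2 (≡-mod-sym 1≡p))) (congruent {3} {0} refl)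
      3∣q : 3 ∣ q
      3∣q = ≡-mod⇒∣∸ (≡-mod-sym q≡0)
    classify 2 _ 2≡p = inj₂ (≡-mod-sym 2≡p)
    classify (suc (suc (suc r))) (s≤s (s≤s (s≤s ()))) _

  no-solution-m≡1 : ∀ x z → p ^ x + (2 * q) ^ 1 ≢ z * z
  no-solution-m≡1 x z eq₁ with even-or-odd x | trans (cong (p ^ x +_) (sym (*-identityʳ (2 * q)))) eq₁
  ... | even h | eq = case square≡⇒SquareMod8 z z²≡7 of λ ()
    where
    z²≡7 : z * z ≡ 7 mod 8
    z²≡7 = begin
      z * z                ≡⟨ eq ⟨
      p ^ (2 * h) + 2 * q  ≈⟨ +-cong-mod (^-even-mod p²≡1-mod-8 h) 2q≡6-mod-8 ⟩
      1 + 6                ∎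
      where open ≡-mod-Reasoning 8
  ... | odd h  | eq = 2-is-not-a-square-mod p z (p ^ (2 * h) + 4) p≡3,5 (trans (sym eq) (regroup p (p ^ (2 * h))))
    where
    regroup : ∀ p a → p * a + 2 * (2 * p + 1) ≡ p * (a + 4) + 2
    regroup = solve-∀

  p∤2*2q : ¬ p ∣ 2 * (2 * q)
  p∤2*2q p∣4q with euclidsLemma 2 (2 * q) p-prime p∣4q
  ... | inj₁ p∣2  = p∤2 p∣2
  ... | inj₂ p∣2q = [ p∤2 , p∤q ]′ (euclidsLemma 2 q p-prime p∣2q)

  no-solution-m≡2 : ∀ x z → p ^ x + (2 * q) ^ 2 ≢ z * z
  no-solution-m≡2 x z eq₂ with trans (cong (λ w → p ^ x + 2 * q * w) (sym (*-identityʳ (2 * q)))) eq₂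
  ... | eq with prime-power+square≡square {s = 2 * q} {x} {z} p-prime p∤2*2q eq
  ... | refl = impossible x (trans (+-cancelʳ-≡ _ (p ^ x) _ (trans eq (expand (2 * q)))) (regroup p))
    where
    expand : ∀ s → (1 + s) * (1 + s) ≡ 1 + 2 * s + s * s
    expand = solve-∀
    regroup : ∀ p → 1 + 2 * (2 * (2 * p + 1)) ≡ 5 + 8 * p
    regroup = solve-∀
    impossible : ∀ x → p ^ x ≢ 5 + 8 * p
    impossible zero    ()
    impossible (suc x) p^[1+x]≡5+8p = 5^h≢45 (suc x) (subst (λ n → n ^ suc x ≡ 5 + 8 * n) p≡5 p^[1+x]≡5+8p)
      where
      p≡5 : p ≡ 5
      p≡5 = prime∣prime⇒≡ p-prime (from-yes (prime? 5))
              (∣m+n∣m⇒∣n (subst (p ∣_) (trans p^[1+x]≡5+8p (+-comm 5 (8 * p))) (m∣m*n (p ^ x))) (n∣m*n 8))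

  1+p^h≢2^M*q^y : ∀ k y h M → 1 ≤ M → (2 * k + 1) * y ≡ 2 + M → 1 + p ^ h ≢ 2 ^ M * q ^ y
  1+p^h≢2^M*q^y k y zero M _ odd*y eq =
    case subst (7 ≤_) (sym eq) 7≤2^M*q^y of λ { (s≤s (s≤s ())) }
    where
    7≤2^M*q^y : 7 ≤ 2 ^ M * q ^ y
    7≤2^M*q^y = ≤-trans (7≤q^y (odd*y≡2+M⇒1≤y k y odd*y)) (m≤n*m (q ^ y) (2 ^ M) {{m^n≢0 2 M}})
  1+p^h≢2^M*q^y k y (suc h) 1 _ _ eq = 1≢2-mod-p (begin
    1                  ≈⟨ +-congˡ-mod 1 (p^[1+h]≡0-mod-p h) ⟨
    1 + p ^ suc h      ≡⟨ eq ⟩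
    2 * q ^ y          ≈⟨ *-congˡ-mod 2 (q^y≡1-mod-p y) ⟩
    2                  ∎)
    where open ≡-mod-Reasoning p
  1+p^h≢2^M*q^y k y (suc h) 2 _ odd*y eq =
    3^h≢9603 (suc h) (suc-injective (subst₂ (λ p y → 1 + p ^ suc h ≡ 4 * (2 * p + 1) ^ y)
                                            p≡3 (odd*y≡4⇒y≡4 k y odd*y) eq))
    where
    p≡3 : p ≡ 3
    p≡3 = 1≡4-mod-p⇒p≡3 (begin
      1                  ≈⟨ +-congˡ-mod 1 (p^[1+h]≡0-mod-p h) ⟨
      1 + p ^ suc h      ≡⟨ eq ⟩
      4 * q ^ y          ≈⟨ *-congˡ-mod 4 (q^y≡1-mod-p y) ⟩
      4                  ∎)
      where open ≡-mod-Reasoning p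
  1+p^h≢2^M*q^y k y h (suc (suc (suc M))) _ _ eq =
    1+p^h≢0-mod-8 h (≡-mod-trans (≡⇒≡-mod eq) (∣⇒≡0-mod (∣m⇒∣m*n (q ^ y) (b^c∣b^[c+h] 2 3 M))))

  q^e≢p^g+2 : ∀ e g → 1 ≤ e → q ^ e ≢ p ^ g + 2
  q^e≢p^g+2 e zero 1≤e eq = case subst (7 ≤_) eq (7≤q^y 1≤e) of λ { (s≤s (s≤s (s≤s ()))) }
  q^e≢p^g+2 e (suc g) _ eq = 1≢2-mod-p (begin
    1                  ≈⟨ q^y≡1-mod-p e ⟨
    q ^ e              ≡⟨ eq ⟩
    p ^ suc g + 2      ≈⟨ +-congʳ-mod 2 (p^[1+h]≡0-mod-p g) ⟩
    2                  ∎)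
    where open ≡-mod-Reasoning p

  2^M+p^h≢q^y-mod-8 : ∀ y h M → 1 ≤ y → 8 ∣ 2 ^ M → 2 ^ M + p ^ h ≢ q ^ y
  2^M+p^h≢q^y-mod-8 y h M 1≤y 8∣2^M eq = by-parity (even-or-odd h) (even-or-odd y) 1≤y eq p^h≡q^y
    where
    p^h≡q^y : p ^ h ≡ q ^ y mod 8
    p^h≡q^y = ≡-mod-trans (+-congʳ-mod (p ^ h) (≡-mod-sym (∣⇒≡0-mod 8∣2^M))) (≡⇒≡-mod eq)
    by-parity : ∀ {h y} → EvenOrOdd h → EvenOrOdd y → 1 ≤ y →
                2 ^ M + p ^ h ≡ q ^ y → p ^ h ≡ q ^ y mod 8 → ⊥
    by-parity (even a) (even b) 1≤y eq _ = q^e≢p^g+2 b a 1≤b (2^M+odd²≡square M (p ^ a) (q ^ b) 2∤p^a eq′)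
      where
      1≤b : 1 ≤ b
      1≤b = n≢0⇒n>0 λ { refl → case 1≤y of λ () }
      2∤p^a : ¬ 2 ∣ p ^ a
      2∤p^a 2∣p^a = 2∤p (prime∣^⇒prime∣ prime[2] a 2∣p^a)
      eq′ : 2 ^ M + p ^ a * p ^ a ≡ q ^ b * q ^ b
      eq′ = trans (cong (2 ^ M +_) (sym (^-double p a))) (trans eq (^-double q b))
    by-parity (even a) (odd b) _ _ p^h≡q^y =
      q≢1-mod-8 (≡-mod-sym (≡-mod-trans (≡-mod-sym (^-even-mod p²≡1-mod-8 a))
                                        (≡-mod-trans p^h≡q^y (^-odd-mod q²≡1-mod-8 b))))
    by-parity (odd a) (even b) _ _ p^h≡q^y =
      p≢1-mod-8 (≡-mod-trans (≡-mod-sym (^-odd-mod p²≡1-mod-8 a))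
                             (≡-mod-trans p^h≡q^y (^-even-mod q²≡1-mod-8 b)))
    by-parity (odd a) (odd b) _ _ p^h≡q^y =
      p≢q-mod-8 (≡-mod-trans (≡-mod-sym (^-odd-mod p²≡1-mod-8 a))
                             (≡-mod-trans p^h≡q^y (^-odd-mod q²≡1-mod-8 b)))

  2^M+p^h≢q^y : ∀ k y h M → 1 ≤ M → (2 * k + 1) * y ≡ 2 + M → 2 ^ M + p ^ h ≢ q ^ y
  2^M+p^h≢q^y k y zero 1 _ odd*y eq =
    case subst (7 ≤_) (sym eq) (7≤q^y (odd*y≡2+M⇒1≤y k y odd*y)) of λ { (s≤s (s≤s (s≤s ()))) }
  2^M+p^h≢q^y k y zero 2 _ odd*y eq =
    case subst (7 ≤_) (sym eq) (7≤q^y (odd*y≡2+M⇒1≤y k y odd*y)) of λ { (s≤s (s≤s (s≤s (s≤s (s≤s ()))))) }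
  2^M+p^h≢q^y k y (suc h) 1 _ _ eq = 1≢2-mod-p (begin
    1                  ≈⟨ q^y≡1-mod-p y ⟨
    q ^ y              ≡⟨ eq ⟨
    2 + p ^ suc h      ≈⟨ +-congˡ-mod 2 (p^[1+h]≡0-mod-p h) ⟩
    2                  ∎)
    where open ≡-mod-Reasoning p
  2^M+p^h≢q^y k y (suc h) 2 _ odd*y eq =
    3^h≢2397 (suc h) (+-cancelˡ-≡ 4 _ _ (subst₂ (λ p y → 4 + p ^ suc h ≡ (2 * p + 1) ^ y)
                                                p≡3 (odd*y≡4⇒y≡4 k y odd*y) eq))
    where
    p≡3 : p ≡ 3
    p≡3 = 1≡4-mod-p⇒p≡3 (begin
      1                  ≈⟨ q^y≡1-mod-p y ⟨
      q ^ y              ≡⟨ eq ⟨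
      4 + p ^ suc h      ≈⟨ +-congˡ-mod 4 (p^[1+h]≡0-mod-p h) ⟩
      4                  ∎)
      where open ≡-mod-Reasoning p
  2^M+p^h≢q^y k y h (suc (suc (suc M))) _ odd*y eq =
    2^M+p^h≢q^y-mod-8 y h (3 + M) (odd*y≡2+M⇒1≤y k y odd*y) (b^c∣b^[c+h] 2 3 M) eq

  q^y+p^h≡2^M : ∀ k y h M → (2 * k + 1) * y ≡ 2 + M → q ^ y + p ^ h ≡ 2 ^ M →
                p ≡ 3 × h ≡ 0 × y ≡ 1 × M ≡ 3
  q^y+p^h≡2^M k y h M odd*y eq with even-or-odd y | even-or-odd M
  ... | even b | _ = ⊥-elim (1+p^h≢0-mod-8 h (begin
    1 + p ^ h             ≈⟨ +-congʳ-mod (p ^ h) (^-even-mod q²≡1-mod-8 b) ⟨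
    q ^ (2 * b) + p ^ h   ≡⟨ eq ⟩
    2 ^ M                 ≈⟨ ∣⇒≡0-mod 8∣2^M ⟩
    0                     ∎))
    where
    open ≡-mod-Reasoning 8
    8∣2^M : 8 ∣ 2 ^ M
    8∣2^M = b^c≤b^j⇒b^c∣b^j {2} {3} {M} (s≤s (s≤s z≤n))
              (subst (8 ≤_) eq (+-mono-≤ (7≤q^y (odd*y≡2+M⇒1≤y k (2 * b) odd*y)) (1≤p^h h)))
  ... | odd b  | even c = ⊥-elim (odd*odd≢2+2c k b c odd*y)
  ... | odd b  | odd c with p≡3∨p≡2-mod-3
  ...   | inj₁ p≡3 =
    p≡3 , 7^y+3^h≡2^M b h c (subst (λ p → (2 * p + 1) ^ (1 + 2 * b) + p ^ h ≡ 2 ^ (1 + 2 * c)) p≡3 eq)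
  ...   | inj₂ p≡2 = case ≡-mod-trans (≡-mod-sym (∣⇒≡0-mod 3∣p)) p≡2 of λ { (congruent ()) }
    where
    q≡2 : q ≡ 2 mod 3
    q≡2 = ≡-mod-trans (+-congʳ-mod 1 (*-congˡ-mod 2 p≡2)) (congruent refl)
    q²≡1 : q ^ 2 ≡ 1 mod 3
    q²≡1 = ≡-mod-trans (^-cong-mod 2 q≡2) (congruent refl)
    2≡2+p^h : 2 ≡ 2 + p ^ h mod 3
    2≡2+p^h = begin
      2                        ≈⟨ ^-odd-mod {c = 2} (congruent refl) c ⟨
      2 ^ (1 + 2 * c)          ≡⟨ eq ⟨
      q ^ (1 + 2 * b) + p ^ h  ≈⟨ +-congʳ-mod (p ^ h) (≡-mod-trans (^-odd-mod q²≡1 b) q≡2) ⟩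
      2 + p ^ h                ∎
      where open ≡-mod-Reasoning 3
    3∣p : 3 ∣ p
    3∣p = prime∣^⇒prime∣ (from-yes (prime? 3)) h
            (subst (3 ∣_) (m+n∸m≡n 2 (p ^ h)) (≡-mod⇒∣∸ 2≡2+p^h))

  u⊥u+p^h : ∀ u h N y → u * (u + p ^ h) ≡ 2 ^ N * q ^ y → Coprime u (u + p ^ h)
  u⊥u+p^h u h N y u*v≡ = coprime-sym (coprime-+ (coprime-sym (prime∤⇒coprime-^ p-prime p∤u h)))
    where
    p∤u : ¬ p ∣ u
    p∤u p∣u with euclidsLemma (2 ^ N) (q ^ y) p-prime (subst (p ∣_) u*v≡ (∣m⇒∣m*n (u + p ^ h) p∣u))
    ... | inj₁ p∣2^N = p∤2 (prime∣^⇒prime∣ p-prime N p∣2^N)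
    ... | inj₂ p∣q^y = p∤q (prime∣^⇒prime∣ p-prime y p∣q^y)

  solutions-even-x : ∀ k y h N z → 1 ≤ N → (2 * k + 1) * y ≡ 2 + N →
                     4 * (2 ^ N * q ^ y) + p ^ h * p ^ h ≡ z * z →
                     p ≡ 3 × k ≡ 2 × 2 * h ≡ 0 × y ≡ 1 × z ≡ 15
  solutions-even-x k y h N z 1≤N odd*y eq
    with u , z≡p^h+2u , 2^N*q^y≡u*v ← 4N+square≡square (2 ^ N * q ^ y) (p ^ h) z eq
    with coprime-split {M = N} {N = y} prime[2] q-prime (sym 2^N*q^y≡u*v) (u⊥u+p^h u h N y (sym 2^N*q^y≡u*v))
  ... | inj₁ (refl , v≡) = ⊥-elim (1+p^h≢2^M*q^y k y h N 1≤N odd*y v≡)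
  ... | inj₂ (inj₁ (refl , v≡)) = ⊥-elim (2^M+p^h≢q^y k y h N 1≤N odd*y v≡)
  ... | inj₂ (inj₂ (inj₂ (refl , v≡1))) =
    case subst (2 ≤_) v≡1 (+-mono-≤ (*-mono-≤ (m^n>0 2 N) (m^n>0 q y)) (1≤p^h h)) of λ { (s≤s ()) }
  ... | inj₂ (inj₂ (inj₁ (refl , v≡))) with q^y+p^h≡2^M k y h N odd*y v≡
  ...   | p≡3 , refl , refl , refl = p≡3 , k≡2 , refl , refl , z≡15
    where
    k≡2 : k ≡ 2
    k≡2 = *-cancelˡ-≡ k 2 2 (+-cancelʳ-≡ 1 (2 * k) 4 (trans (sym (*-identityʳ (2 * k + 1))) odd*y))
    z≡15 : z ≡ 15
    z≡15 = trans z≡p^h+2u (cong (λ p → 1 + 2 * ((2 * p + 1) * 1)) p≡3)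

  solutions-m≥3 : ∀ k x y z M → 1 ≤ M → (2 * k + 1) * y ≡ 2 + M →
                  p ^ x + (2 ^ (2 * k + 1) * q) ^ y ≡ z * z → p ≡ 3 × k ≡ 2 × x ≡ 0 × y ≡ 1 × z ≡ 15
  solutions-m≥3 k x y z (suc M) 1≤M odd*y eq
    with even-or-odd x
       | subst (λ m → p ^ x + 2 ^ m * q ^ y ≡ z * z) odd*y
               (trans (cong (p ^ x +_) (sym ([2^a*b]^y (2 * k + 1) q y))) eq)
  ... | even h | eq′ = solutions-even-x k y h (suc M) z 1≤M odd*y
    (trans (regroup (2 ^ suc M) (q ^ y) (p ^ h))
           (trans (cong (_+ 2 ^ (3 + M) * q ^ y) (sym (^-double p h))) eq′))
    where
    regroup : ∀ a b c → 4 * (a * b) + c * c ≡ c * c + 2 * (2 * a) * b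
    regroup = solve-∀
  ... | odd h  | eq′ = ⊥-elim (≡3,5⇒¬SquareMod8 p p≡3,5 (square≡⇒SquareMod8 z (begin
    z * z                                     ≡⟨ eq′ ⟨
    p ^ (1 + 2 * h) + 2 ^ (3 + M) * q ^ y     ≈⟨ +-cong-mod (^-odd-mod p²≡1-mod-8 h)
                                                            (∣⇒≡0-mod (∣m⇒∣m*n (q ^ y) (b^c∣b^[c+h] 2 3 M))) ⟩
    p + 0                                     ≡⟨ +-identityʳ p ⟩
    p                                         ∎)))
    where open ≡-mod-Reasoning 8

-- m = (2k + 1)y is the exponent of 2 in (2^(2k+1) q)^y.
data TwoAdicExponent : ℕ → ℕ → Set where
  m≡0   : ∀ k → TwoAdicExponent k 0
  m≡1   : TwoAdicExponent 0 1
  m≡2   : TwoAdicExponent 0 2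
  m≡2+M : ∀ {k y} M → 1 ≤ M → (2 * k + 1) * y ≡ 2 + M → TwoAdicExponent k y

two-adic-exponent : ∀ k y → TwoAdicExponent k y
two-adic-exponent k       zero                = m≡0 k
two-adic-exponent zero    1                   = m≡1
two-adic-exponent zero    2                   = m≡2
two-adic-exponent zero    (suc (suc (suc y))) = m≡2+M (suc y) (s≤s z≤n) (+-identityʳ (3 + y))
two-adic-exponent (suc k) (suc y)             =
  m≡2+M (1 + 2 * k + (2 * suc k + 1) * y) (s≤s z≤n) (expand k y)
  where
  expand : ∀ k y → (2 * suc k + 1) * suc y ≡ 2 + (1 + 2 * k + (2 * suc k + 1) * y)
  expand = solve-∀

open SophieGermain using (p∤2; no-solution-m≡1; no-solution-m≡2; solutions-m≥3)

theorem4p1 : (p k x y z : ℕ) → SophieGermainPrime p →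
    (p % 8 ≡ 3 ⊎ p % 8 ≡ 5) →
    p ^ x + (2 ^ (2 * k + 1) * (2 * p + 1)) ^ y ≡ z ^ 2 →
    (p ≡ 3 × x ≡ 1 × y ≡ 0 × z ≡ 2)
    ⊎ (p ≡ 3 × k ≡ 2 × x ≡ 0 × y ≡ 1 × z ≡ 15)
theorem4p1 p k x y z (p-prime , q-prime) p≡3,5 eq
  with two-adic-exponent k y | trans eq (cong (z *_) (*-identityʳ z))
... | m≡0 _ | eq′ = let p≡3 , x≡1 , z≡2 = prime-power+1≡square p-prime (p∤2 p-prime q-prime p≡3,5) eq′
                    in  inj₁ (p≡3 , x≡1 , refl , z≡2)
... | m≡1 | eq′ = ⊥-elim (no-solution-m≡1 p-prime q-prime p≡3,5 x z eq′)
... | m≡2 | eq′ = ⊥-elim (no-solution-m≡2 p-prime q-prime p≡3,5 x z eq′)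
... | m≡2+M M 1≤M odd*y≡2+M | eq′ =
  inj₂ (solutions-m≥3 p-prime q-prime p≡3,5 k x y z M 1≤M odd*y≡2+M eq′)
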